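{- For integers $n \geq k \geq 1$ let \[ v_{n, k} = (-1)^{n}(2k)!\frac{2^{2(n - k)}}{n^2\binom{2n}{n}}h_{k, n}, \] and set $v_{n,k} = 0$ for $k > n$, where $h_{1, n} = 1$ and $h_{k, n} = \sum_{j = k - 1}^{n - 1}\frac{1}{j^2}h_{k - 1, j}$ for $k \geq 2$. Then for all $M \in \mathbb{N}$ and all $j \in \mathbb{N}$, \[ \sum_{k = 0}^{M - 1}2^{2(M + k) + 1}\frac{M - k}{2k + 1}\binom{M + k}{2k}v_{M + k, j} = 2^{2j + 1}v_{2M - 1, j} \] and \[ \sum_{k = 0}^{M}2^{2(M + k) + 1}\binom{M + k}{2k}v_{M + k, j} = 2^{2j + 1}v_{2M, j}. \]
   Context: Convention: $\binom{n}{k} = 0$ whenever $k < 0$ or $n < k$. $\mathbb{N} = \{1,2,3,\dots\}$. -}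

module Defs where

open import Data.Nat as ℕ using (ℕ; zero; suc; _∸_; _^_; _≤ᵇ_; _!)
open import Data.Nat.Combinatorics using (_C_)
open import Data.Integer using (+_)
open import Data.Rational using (ℚ; 0ℚ; 1ℚ; _+_; _*_; -_; _/_)
open import Data.Bool using (if_then_else_)

ℕ→ℚ : ℕ → ℚ
ℕ→ℚ n = + n / 1

-- reciprocal of a natural number; only ever applied to nonzero arguments
-- (the value at 0 is an irrelevant convention)
inv : ℕ → ℚ
inv zero    = 0ℚ
inv (suc m) = + 1 / suc m

sumℚ : ℕ → (ℕ → ℚ) → ℚ
sumℚ zero    f = 0ℚ
sumℚ (suc N) f = sumℚ N f + f N

-- Σ_{j=a}^{b} f j  (empty, i.e. 0, when b < a)
sumFromTo : ℕ → ℕ → (ℕ → ℚ) → ℚ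
sumFromTo a b f = sumℚ (suc b ∸ a) (λ i → f (a ℕ.+ i))

sgn : ℕ → ℚ
sgn zero    = 1ℚ
sgn (suc n) = - sgn n

-- h k n  =  h_{k,n}:  h_{1,n} = 1,
-- h_{k,n} = Σ_{j=k-1}^{n-1} (1/j²) h_{k-1,j}  for k ≥ 2.
-- (h 0 n is never used; set to 0.)
h : ℕ → ℕ → ℚ
h zero          n = 0ℚ
h (suc zero)    n = 1ℚ
h (suc (suc k)) n = sumFromTo (suc k) (n ∸ 1) (λ j → inv (j ℕ.* j) * h (suc k) j)

-- v n k = v_{n,k} = (-1)^n (2k)! 2^{2(n-k)} / (n² binom(2n,n)) h_{k,n}  for n ≥ k ≥ 1,
-- and 0 for k > n.  (k = 0 is outside the paper's range; set to 0.)
v : ℕ → ℕ → ℚ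
v n zero    = 0ℚ
v n (suc k) =
  if suc k ≤ᵇ n
  then sgn n * ℕ→ℚ ((2 ℕ.* suc k) !) * ℕ→ℚ (2 ^ (2 ℕ.* (n ∸ suc k)))
         * inv (n ℕ.* n ℕ.* ((2 ℕ.* n) C n)) * h (suc k) n
  else 0ℚ

module Submission where

-- Write σ(n,u) = 2^{2n+1} C(n,u); after absorbing the factor
-- (M-k)/(2k+1) into the binomial, the two sums expand v_{2M-1} over
-- σ(M+i,2i+1) and v_{2M} over σ(M+i,2i).  The sequence v satisfies the
-- three-term recurrence (in n, for n ≥ 1)
--   (2n+1)(2n+2) v_{n+1,k+1} + 4n² v_{n,k+1} + (2k+1)(2k+2) v_{n,k} = 0,
-- which comes from h_{k,n+1} = h_{k,n} + h_{k-1,n}/n².  Applying it to the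
-- target and to every summand of an expansion of v_T turns it into an
-- expansion of v_{T+1}, provided the new coefficients satisfy an index-wise
-- "transfer condition"; for our binomial coefficients this condition is a
-- single binomial identity.  Induction along T = 1, 2, 3, … gives both
-- families.

open import Defs
open import Data.Nat as ℕ using (ℕ; zero; suc; _∸_; _^_; _≤_; _<_; z≤n; s≤s; _!; _≤ᵇ_)
import Data.Nat.Properties as ℕP
open import Data.Nat.Combinatorics using (_C_; nCk+nC[k+1]≡[n+1]C[k+1]; k>n⇒nCk≡0; nC1≡n)
import Data.Nat.Tactic.RingSolver as ℕSolver
import Data.Integer as ℤ
import Data.Integer.Properties as ℤP
open import Data.Rational as ℚ using (ℚ; mkℚ; _+_; _*_; -_; _-_; 0ℚ; 1ℚ; toℚᵘ)
open import Data.Rational.Properties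
import Data.Rational.Unnormalised as ℚᵘ
import Data.Rational.Unnormalised.Properties as ℚᵘP
import Data.Nat.Coprimality as Coprime
open import Data.Rational.Solver using (module +-*-Solver)
open +-*-Solver
open import Data.Bool using (true; false) renaming (T to IsTrue)
open import Data.Product using (_×_; _,_; proj₁; proj₂)
open import Relation.Nullary using (yes; no)
open import Relation.Binary.PropositionalEquality

ℕ→ℚ≡mkℚ : ∀ n → ℕ→ℚ n ≡ mkℚ (ℤ.+ n) 0 (Coprime.sym (Coprime.1-coprimeTo n))
ℕ→ℚ≡mkℚ n = normalize-coprime (Coprime.sym (Coprime.1-coprimeTo n))

inv≡mkℚ : ∀ m → inv (suc m) ≡ mkℚ (ℤ.+ 1) m (Coprime.1-coprimeTo (suc m))
inv≡mkℚ m = normalize-coprime (Coprime.1-coprimeTo (suc m))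

ℕ→ℚ-+ : ∀ a b → ℕ→ℚ (a ℕ.+ b) ≡ ℕ→ℚ a + ℕ→ℚ b
ℕ→ℚ-+ a b = toℚᵘ-injective (ℚᵘP.≃-trans (toℚᵘ-cong (ℕ→ℚ≡mkℚ (a ℕ.+ b)))
  (ℚᵘP.≃-trans (ℚᵘ.*≡* numerators) (ℚᵘP.≃-sym (ℚᵘP.≃-trans (toℚᵘ-homo-+ (ℕ→ℚ a) (ℕ→ℚ b))
    (ℚᵘP.≃-reflexive (cong₂ ℚᵘ._+_ (cong toℚᵘ (ℕ→ℚ≡mkℚ a)) (cong toℚᵘ (ℕ→ℚ≡mkℚ b))))))))
  where
  numerators : ℤ.+ (a ℕ.+ b) ℤ.* ℤ.+ 1 ≡ (ℤ.+ a ℤ.* ℤ.+ 1 ℤ.+ ℤ.+ b ℤ.* ℤ.+ 1) ℤ.* ℤ.+ 1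
  numerators = begin
    ℤ.+ (a ℕ.+ b) ℤ.* ℤ.+ 1                        ≡⟨ ℤP.*-identityʳ _ ⟩
    ℤ.+ a ℤ.+ ℤ.+ b                                ≡⟨ sym (cong₂ ℤ._+_ (ℤP.*-identityʳ (ℤ.+ a)) (ℤP.*-identityʳ (ℤ.+ b))) ⟩
    ℤ.+ a ℤ.* ℤ.+ 1 ℤ.+ ℤ.+ b ℤ.* ℤ.+ 1            ≡⟨ sym (ℤP.*-identityʳ _) ⟩
    (ℤ.+ a ℤ.* ℤ.+ 1 ℤ.+ ℤ.+ b ℤ.* ℤ.+ 1) ℤ.* ℤ.+ 1 ∎
    where open ≡-Reasoning

ℕ→ℚ-* : ∀ a b → ℕ→ℚ (a ℕ.* b) ≡ ℕ→ℚ a * ℕ→ℚ b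
ℕ→ℚ-* a b = toℚᵘ-injective (ℚᵘP.≃-trans (toℚᵘ-cong (ℕ→ℚ≡mkℚ (a ℕ.* b)))
  (ℚᵘP.≃-trans (ℚᵘ.*≡* (cong (ℤ._* ℤ.+ 1) (ℤP.pos-* a b))) (ℚᵘP.≃-sym (ℚᵘP.≃-trans (toℚᵘ-homo-* (ℕ→ℚ a) (ℕ→ℚ b))
    (ℚᵘP.≃-reflexive (cong₂ ℚᵘ._*_ (cong toℚᵘ (ℕ→ℚ≡mkℚ a)) (cong toℚᵘ (ℕ→ℚ≡mkℚ b))))))))

inv-inverseˡ : ∀ m → inv (suc m) * ℕ→ℚ (suc m) ≡ 1ℚ
inv-inverseˡ m = toℚᵘ-injective (ℚᵘP.≃-trans (toℚᵘ-homo-* (inv (suc m)) (ℕ→ℚ (suc m)))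
  (ℚᵘP.≃-trans (ℚᵘP.≃-reflexive (cong₂ ℚᵘ._*_ (cong toℚᵘ (inv≡mkℚ m)) (cong toℚᵘ (ℕ→ℚ≡mkℚ (suc m)))))
    (ℚᵘ.*≡* numerators)))
  where
  numerators : (ℤ.+ 1 ℤ.* ℤ.+ suc m) ℤ.* ℤ.+ 1 ≡ ℤ.+ 1 ℤ.* ℤ.+ (suc m ℕ.* 1)
  numerators = trans (ℤP.*-identityʳ _) (cong (ℤ.+ 1 ℤ.*_) (cong ℤ.+_ (sym (ℕP.*-identityʳ (suc m)))))

inv-inverseʳ : ∀ m → ℕ→ℚ (suc m) * inv (suc m) ≡ 1ℚ
inv-inverseʳ m = trans (*-comm (ℕ→ℚ (suc m)) (inv (suc m))) (inv-inverseˡ m)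

ℕ→ℚ-cancelˡ : ∀ {a x y} → 1 ≤ a → ℕ→ℚ a * x ≡ ℕ→ℚ a * y → x ≡ y
ℕ→ℚ-cancelˡ {suc m} {x} {y} _ eq = begin
  x                             ≡⟨ sym (*-identityˡ x) ⟩
  1ℚ * x                        ≡⟨ cong (_* x) (sym (inv-inverseˡ m)) ⟩
  inv (suc m) * ℕ→ℚ (suc m) * x   ≡⟨ *-assoc (inv (suc m)) _ x ⟩
  inv (suc m) * (ℕ→ℚ (suc m) * x) ≡⟨ cong (inv (suc m) *_) eq ⟩
  inv (suc m) * (ℕ→ℚ (suc m) * y) ≡⟨ sym (*-assoc (inv (suc m)) _ y) ⟩
  inv (suc m) * ℕ→ℚ (suc m) * y   ≡⟨ cong (_* y) (inv-inverseˡ m) ⟩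
  1ℚ * y                        ≡⟨ *-identityˡ y ⟩
  y                             ∎
  where open ≡-Reasoning

inv-* : ∀ a b → inv (suc a ℕ.* suc b) ≡ inv (suc a) * inv (suc b)
inv-* a b = ℕ→ℚ-cancelˡ {suc a ℕ.* suc b} (s≤s z≤n) (begin
  ℕ→ℚ (suc a ℕ.* suc b) * inv (suc a ℕ.* suc b)  ≡⟨ inv-inverseʳ (b ℕ.+ a ℕ.* suc b) ⟩
  1ℚ                                          ≡⟨ sym (cong₂ _*_ (inv-inverseʳ a) (inv-inverseʳ b)) ⟩
  (A * inv (suc a)) * (B * inv (suc b))        ≡⟨ solve 4 (λ A B x y → (A :* x) :* (B :* y) := (A :* B) :* (x :* y)) refl A B (inv (suc a)) (inv (suc b)) ⟩
  (A * B) * (inv (suc a) * inv (suc b))        ≡⟨ cong (_* (inv (suc a) * inv (suc b))) (sym (ℕ→ℚ-* (suc a) (suc b))) ⟩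
  ℕ→ℚ (suc a ℕ.* suc b) * (inv (suc a) * inv (suc b)) ∎)
  where
  open ≡-Reasoning
  A = ℕ→ℚ (suc a)
  B = ℕ→ℚ (suc b)

ℕ→ℚ*inv-cancel : ∀ {a b} → 1 ≤ a → 1 ≤ b → ℕ→ℚ a * inv (a ℕ.* b) ≡ inv b
ℕ→ℚ*inv-cancel {suc a} {suc b} _ _ = begin
  ℕ→ℚ (suc a) * inv (suc a ℕ.* suc b)       ≡⟨ cong (ℕ→ℚ (suc a) *_) (inv-* a b) ⟩
  ℕ→ℚ (suc a) * (inv (suc a) * inv (suc b)) ≡⟨ sym (*-assoc (ℕ→ℚ (suc a)) _ _) ⟩
  ℕ→ℚ (suc a) * inv (suc a) * inv (suc b)   ≡⟨ cong (_* inv (suc b)) (inv-inverseʳ a) ⟩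
  1ℚ * inv (suc b)                        ≡⟨ *-identityˡ _ ⟩
  inv (suc b)                             ∎
  where open ≡-Reasoning

sum-cong : ∀ N {f g : ℕ → ℚ} → (∀ i → i < N → f i ≡ g i) → sumℚ N f ≡ sumℚ N g
sum-cong zero    f≡g = refl
sum-cong (suc N) f≡g = cong₂ _+_ (sum-cong N (λ i i<N → f≡g i (ℕP.m<n⇒m<1+n i<N))) (f≡g N ℕP.≤-refl)

sum-zero : ∀ N {f : ℕ → ℚ} → (∀ i → f i ≡ 0ℚ) → sumℚ N f ≡ 0ℚ
sum-zero zero    f≡0 = refl
sum-zero (suc N) f≡0 = trans (cong₂ _+_ (sum-zero N f≡0) (f≡0 N)) (+-identityˡ 0ℚ)

sum-+ : ∀ N (f g : ℕ → ℚ) → sumℚ N (λ i → f i + g i) ≡ sumℚ N f + sumℚ N g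
sum-+ zero    f g = sym (+-identityˡ 0ℚ)
sum-+ (suc N) f g = trans (cong (_+ (f N + g N)) (sum-+ N f g))
  (solve 4 (λ a b c d → (a :+ b) :+ (c :+ d) := (a :+ c) :+ (b :+ d)) refl (sumℚ N f) (sumℚ N g) (f N) (g N))

sum-*ˡ : ∀ N c (f : ℕ → ℚ) → sumℚ N (λ i → c * f i) ≡ c * sumℚ N f
sum-*ˡ zero    c f = sym (*-zeroʳ c)
sum-*ˡ (suc N) c f = trans (cong (_+ (c * f N)) (sum-*ˡ N c f)) (sym (*-distribˡ-+ c (sumℚ N f) (f N)))

sum-drop-head : ∀ N (f : ℕ → ℚ) → f 0 ≡ 0ℚ → sumℚ (suc N) f ≡ sumℚ N (λ i → f (suc i))
sum-drop-head zero    f f0≡0 = trans (+-identityˡ (f 0)) f0≡0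
sum-drop-head (suc N) f f0≡0 = cong (_+ f (suc N)) (sum-drop-head N f f0≡0)

C-absorb : ∀ n k → suc k ℕ.* (suc n C suc k) ≡ suc n ℕ.* (n C k)
C-absorb zero    zero    = refl
C-absorb zero    (suc k) = ℕP.*-zeroʳ (suc (suc k))
C-absorb (suc n) zero    = trans (ℕP.+-identityʳ _) (trans (nC1≡n (suc (suc n))) (sym (ℕP.*-identityʳ (suc (suc n)))))
C-absorb (suc n) (suc k) = begin
  suc (suc k) ℕ.* (suc n′ C suc (suc k))     ≡⟨ cong (suc (suc k) ℕ.*_) (sym (nCk+nC[k+1]≡[n+1]C[k+1] n′ (suc k))) ⟩
  suc (suc k) ℕ.* (X ℕ.+ Y)                 ≡⟨ regroup (suc k) X Y ⟩
  X ℕ.+ (suc k ℕ.* X ℕ.+ suc (suc k) ℕ.* Y)  ≡⟨ cong (X ℕ.+_) (cong₂ ℕ._+_ (C-absorb n k) (C-absorb n (suc k))) ⟩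
  X ℕ.+ (n′ ℕ.* (n C k) ℕ.+ n′ ℕ.* (n C suc k)) ≡⟨ cong (X ℕ.+_) (sym (ℕP.*-distribˡ-+ n′ (n C k) (n C suc k))) ⟩
  X ℕ.+ n′ ℕ.* (n C k ℕ.+ n C suc k)           ≡⟨ cong (λ z → X ℕ.+ n′ ℕ.* z) (nCk+nC[k+1]≡[n+1]C[k+1] n k) ⟩
  X ℕ.+ n′ ℕ.* X                             ∎
  where
  open ≡-Reasoning
  n′ = suc n
  X = n′ C suc k
  Y = n′ C suc (suc k)
  regroup : ∀ a X Y → suc a ℕ.* (X ℕ.+ Y) ≡ X ℕ.+ (a ℕ.* X ℕ.+ suc a ℕ.* Y)
  regroup = ℕSolver.solve-∀

C-ratio : ∀ n k → suc k ℕ.* (n C suc k) ≡ (n ∸ k) ℕ.* (n C k)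
C-ratio n k with k ℕ.≤? n
... | yes k≤n = ℕP.+-cancelˡ-≡ (suc k ℕ.* (n C k)) _ _ (begin
  suc k ℕ.* (n C k) ℕ.+ suc k ℕ.* (n C suc k) ≡⟨ sym (ℕP.*-distribˡ-+ (suc k) (n C k) (n C suc k)) ⟩
  suc k ℕ.* (n C k ℕ.+ n C suc k)             ≡⟨ cong (suc k ℕ.*_) (nCk+nC[k+1]≡[n+1]C[k+1] n k) ⟩
  suc k ℕ.* (suc n C suc k)                   ≡⟨ C-absorb n k ⟩
  suc n ℕ.* (n C k)                           ≡⟨ cong (ℕ._* (n C k)) (sym (ℕP.m+[n∸m]≡n (s≤s k≤n))) ⟩
  (suc k ℕ.+ (n ∸ k)) ℕ.* (n C k)             ≡⟨ ℕP.*-distribʳ-+ (n C k) (suc k) (n ∸ k) ⟩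
  suc k ℕ.* (n C k) ℕ.+ (n ∸ k) ℕ.* (n C k)   ∎)
  where open ≡-Reasoning
... | no k≰n = begin
  suc k ℕ.* (n C suc k) ≡⟨ cong (suc k ℕ.*_) (k>n⇒nCk≡0 (ℕP.m<n⇒m<1+n n<k)) ⟩
  suc k ℕ.* 0          ≡⟨ ℕP.*-zeroʳ (suc k) ⟩
  0                    ≡⟨ sym (cong (ℕ._* (n C k)) (ℕP.m≤n⇒m∸n≡0 (ℕP.<⇒≤ n<k))) ⟩
  (n ∸ k) ℕ.* (n C k)  ∎
  where
  open ≡-Reasoning
  n<k = ℕP.≰⇒> k≰n

C-pos : ∀ {n k} → k ≤ n → 1 ≤ n C k
C-pos {n}     {zero}  _         = s≤s z≤n
C-pos {suc n} {suc k} (s≤s k≤n) = ℕP.≤-trans (C-pos k≤n)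
  (ℕP.≤-trans (ℕP.m≤m+n (n C k) (n C suc k)) (ℕP.≤-reflexive (nCk+nC[k+1]≡[n+1]C[k+1] n k)))

-- τ n = (2n+1)(2n+2) = (2n+2)!/(2n)!, the factor produced by one step of
-- the central binomial coefficients and of the even factorials.
τ : ℕ → ℕ
τ n = suc (2 ℕ.* n) ℕ.* suc (suc (2 ℕ.* n))

central-step : ∀ n → suc n ℕ.* suc n ℕ.* ((2 ℕ.* suc n) C suc n) ≡ τ n ℕ.* ((2 ℕ.* n) C n)
central-step n = begin
  suc n ℕ.* suc n ℕ.* ((2 ℕ.* suc n) C suc n)       ≡⟨ cong (λ z → suc n ℕ.* suc n ℕ.* (z C suc n)) (double-suc n) ⟩
  suc n ℕ.* suc n ℕ.* (suc (suc 2n) C suc n)        ≡⟨ ℕP.*-assoc (suc n) (suc n) _ ⟩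
  suc n ℕ.* (suc n ℕ.* (suc (suc 2n) C suc n))      ≡⟨ cong (suc n ℕ.*_) (C-absorb (suc 2n) n) ⟩
  suc n ℕ.* (suc (suc 2n) ℕ.* (suc 2n C n))         ≡⟨ swap (suc n) (suc (suc 2n)) (suc 2n C n) ⟩
  suc (suc 2n) ℕ.* (suc n ℕ.* (suc 2n C n))         ≡⟨ cong (suc (suc 2n) ℕ.*_) middle ⟩
  suc (suc 2n) ℕ.* (suc 2n ℕ.* (2n C n))            ≡⟨ swap (suc (suc 2n)) (suc 2n) (2n C n) ⟩
  suc 2n ℕ.* (suc (suc 2n) ℕ.* (2n C n))            ≡⟨ sym (ℕP.*-assoc (suc 2n) (suc (suc 2n)) (2n C n)) ⟩
  τ n ℕ.* (2n C n)                                 ∎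
  where
  open ≡-Reasoning
  2n = 2 ℕ.* n
  double-suc : ∀ n → 2 ℕ.* suc n ≡ suc (suc (2 ℕ.* n))
  double-suc = ℕSolver.solve-∀
  swap : ∀ x y z → x ℕ.* (y ℕ.* z) ≡ y ℕ.* (x ℕ.* z)
  swap = ℕSolver.solve-∀
  -- (n+1)·C(2n+1,n) = (2n+1)·C(2n,n), by symmetry C(2n+1,n) = C(2n+1,n+1)
  middle : suc n ℕ.* (suc 2n C n) ≡ suc 2n ℕ.* (2n C n)
  middle = begin
    suc n ℕ.* (suc 2n C n)          ≡⟨ cong (ℕ._* (suc 2n C n)) (sym (trans (cong (_∸ n) (split n)) (ℕP.m+n∸m≡n n (suc n)))) ⟩
    (suc 2n ∸ n) ℕ.* (suc 2n C n)   ≡⟨ sym (C-ratio (suc 2n) n) ⟩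
    suc n ℕ.* (suc 2n C suc n)      ≡⟨ C-absorb 2n n ⟩
    suc 2n ℕ.* (2n C n)             ∎
    where
    split : ∀ n → suc (2 ℕ.* n) ≡ n ℕ.+ suc n
    split = ℕSolver.solve-∀

-- Dividing by C(p,t), both ratios C(p+1,t+1)/C(p,t) and C(p+1,t+2)/C(p,t)
-- are rational functions of t and d, and the identity becomes a
-- polynomial one.
binomial-identity : ∀ t d →
  τ (t ℕ.+ 2 ℕ.* d) ℕ.* (suc (t ℕ.+ d) C suc t)
    ≡ 4 ℕ.* (suc (suc t) ℕ.* (3 ℕ.* t ℕ.+ 4 ℕ.* d ℕ.+ 2)) ℕ.* (suc (t ℕ.+ d) C suc (suc t))
      ℕ.+ τ (t ℕ.+ d) ℕ.* ((t ℕ.+ d) C t)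
binomial-identity t d = begin
  τ (t ℕ.+ 2 ℕ.* d) ℕ.* C₁
    ≡⟨ split t d C₁ ⟩
  4 ℕ.* (3 ℕ.* t ℕ.+ 4 ℕ.* d ℕ.+ 2) ℕ.* (d ℕ.* C₁) ℕ.+ 2 ℕ.* (suc (2 ℕ.* (t ℕ.+ d))) ℕ.* (suc t ℕ.* C₁)
    ≡⟨ cong₂ (λ x y → 4 ℕ.* (3 ℕ.* t ℕ.+ 4 ℕ.* d ℕ.+ 2) ℕ.* x ℕ.+ 2 ℕ.* (suc (2 ℕ.* (t ℕ.+ d))) ℕ.* y) ratio (C-absorb (t ℕ.+ d) t) ⟩
  4 ℕ.* (3 ℕ.* t ℕ.+ 4 ℕ.* d ℕ.+ 2) ℕ.* (suc (suc t) ℕ.* C₂) ℕ.+ 2 ℕ.* (suc (2 ℕ.* (t ℕ.+ d))) ℕ.* (suc (t ℕ.+ d) ℕ.* C₀)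
    ≡⟨ join t d C₂ C₀ ⟩
  4 ℕ.* (suc (suc t) ℕ.* (3 ℕ.* t ℕ.+ 4 ℕ.* d ℕ.+ 2)) ℕ.* C₂ ℕ.+ τ (t ℕ.+ d) ℕ.* C₀
    ∎
  where
  open ≡-Reasoning
  C₀ = (t ℕ.+ d) C t
  C₁ = suc (t ℕ.+ d) C suc t
  C₂ = suc (t ℕ.+ d) C suc (suc t)
  ratio : d ℕ.* C₁ ≡ suc (suc t) ℕ.* C₂
  ratio = sym (trans (C-ratio (suc (t ℕ.+ d)) (suc t)) (cong (ℕ._* C₁) (ℕP.m+n∸m≡n t d)))
  split : ∀ t d C₁ → (suc (2 ℕ.* (t ℕ.+ 2 ℕ.* d)) ℕ.* suc (suc (2 ℕ.* (t ℕ.+ 2 ℕ.* d)))) ℕ.* C₁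
    ≡ 4 ℕ.* (3 ℕ.* t ℕ.+ 4 ℕ.* d ℕ.+ 2) ℕ.* (d ℕ.* C₁) ℕ.+ 2 ℕ.* (suc (2 ℕ.* (t ℕ.+ d))) ℕ.* (suc t ℕ.* C₁)
  split = ℕSolver.solve-∀
  join : ∀ t d C₂ C₀ →
    4 ℕ.* (3 ℕ.* t ℕ.+ 4 ℕ.* d ℕ.+ 2) ℕ.* (suc (suc t) ℕ.* C₂) ℕ.+ 2 ℕ.* (suc (2 ℕ.* (t ℕ.+ d))) ℕ.* (suc (t ℕ.+ d) ℕ.* C₀)
      ≡ 4 ℕ.* (suc (suc t) ℕ.* (3 ℕ.* t ℕ.+ 4 ℕ.* d ℕ.+ 2)) ℕ.* C₂ ℕ.+ (suc (2 ℕ.* (t ℕ.+ d)) ℕ.* suc (suc (2 ℕ.* (t ℕ.+ d)))) ℕ.* C₀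
  join = ℕSolver.solve-∀

-- σ n u = 2^(2n+1) · C(n,u): the coefficient of v_{n,j} in the sums of the
-- theorem (after absorbing the factor (M-k)/(2k+1) into the binomial).
σ : ℕ → ℕ → ℕ
σ n u = 2 ^ (2 ℕ.* n ℕ.+ 1) ℕ.* (n C u)

pow-step : ∀ n → 2 ^ (2 ℕ.* suc n ℕ.+ 1) ≡ 4 ℕ.* 2 ^ (2 ℕ.* n ℕ.+ 1)
pow-step n = trans (cong (2 ^_) (exponent n)) (ℕP.^-distribˡ-+-* 2 2 (2 ℕ.* n ℕ.+ 1))
  where
  exponent : ∀ n → 2 ℕ.* suc n ℕ.+ 1 ≡ 2 ℕ.+ (2 ℕ.* n ℕ.+ 1)
  exponent = ℕSolver.solve-∀

4^-step : ∀ e → 2 ^ (2 ℕ.* suc e) ≡ 4 ℕ.* 2 ^ (2 ℕ.* e)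
4^-step e = trans (cong (2 ^_) (double-suc e)) (ℕP.^-distribˡ-+-* 2 2 (2 ℕ.* e))
  where
  double-suc : ∀ e → 2 ℕ.* suc e ≡ 2 ℕ.+ 2 ℕ.* e
  double-suc = ℕSolver.solve-∀

-- The binomial identity rewritten for the σ-coefficients, in the form in
-- which it is consumed below (16 n² - 4 T² is the factor produced by the
-- recurrence for v).  The indices are passed through equations so that the
-- lemma applies to the index expressions arising in both summation steps.
σ-identity : ∀ t d {n n′ u u′ p T} →
  n ≡ suc (t ℕ.+ d) → n′ ≡ suc (t ℕ.+ d) → u ≡ suc t → u′ ≡ suc (suc t) → p ≡ t ℕ.+ d → T ≡ t ℕ.+ 2 ℕ.* d →
  τ T ℕ.* σ n u ℕ.+ 4 ℕ.* (T ℕ.* T) ℕ.* σ n′ u′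
    ≡ 4 ℕ.* (4 ℕ.* (n′ ℕ.* n′)) ℕ.* σ n′ u′ ℕ.+ 4 ℕ.* σ p t ℕ.* τ p
σ-identity t d refl refl refl refl refl refl = begin
  τ T ℕ.* (2 ^ (2 ℕ.* suc p ℕ.+ 1) ℕ.* C₁) ℕ.+ 4 ℕ.* (T ℕ.* T) ℕ.* (2 ^ (2 ℕ.* suc p ℕ.+ 1) ℕ.* C₂)
    ≡⟨ cong (λ x → τ T ℕ.* (x ℕ.* C₁) ℕ.+ 4 ℕ.* (T ℕ.* T) ℕ.* (x ℕ.* C₂)) (pow-step p) ⟩
  τ T ℕ.* (4 ℕ.* P ℕ.* C₁) ℕ.+ 4 ℕ.* (T ℕ.* T) ℕ.* (4 ℕ.* P ℕ.* C₂)
    ≡⟨ pull-out (τ T) P C₁ (4 ℕ.* (T ℕ.* T) ℕ.* (4 ℕ.* P ℕ.* C₂)) ⟩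
  4 ℕ.* P ℕ.* (τ T ℕ.* C₁) ℕ.+ 4 ℕ.* (T ℕ.* T) ℕ.* (4 ℕ.* P ℕ.* C₂)
    ≡⟨ cong (λ x → 4 ℕ.* P ℕ.* x ℕ.+ 4 ℕ.* (T ℕ.* T) ℕ.* (4 ℕ.* P ℕ.* C₂)) (binomial-identity t d) ⟩
  4 ℕ.* P ℕ.* (4 ℕ.* (suc (suc t) ℕ.* (3 ℕ.* t ℕ.+ 4 ℕ.* d ℕ.+ 2)) ℕ.* C₂ ℕ.+ τ p ℕ.* C₀) ℕ.+ 4 ℕ.* (T ℕ.* T) ℕ.* (4 ℕ.* P ℕ.* C₂)
    ≡⟨ collect t d P C₂ C₀ ⟩
  4 ℕ.* (4 ℕ.* (suc p ℕ.* suc p)) ℕ.* (4 ℕ.* P ℕ.* C₂) ℕ.+ 4 ℕ.* (P ℕ.* C₀) ℕ.* τ p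
    ≡⟨ cong (λ x → 4 ℕ.* (4 ℕ.* (suc p ℕ.* suc p)) ℕ.* (x ℕ.* C₂) ℕ.+ 4 ℕ.* (P ℕ.* C₀) ℕ.* τ p) (sym (pow-step p)) ⟩
  4 ℕ.* (4 ℕ.* (suc p ℕ.* suc p)) ℕ.* (2 ^ (2 ℕ.* suc p ℕ.+ 1) ℕ.* C₂) ℕ.+ 4 ℕ.* (P ℕ.* C₀) ℕ.* τ p
    ∎
  where
  open ≡-Reasoning
  p = t ℕ.+ d
  T = t ℕ.+ 2 ℕ.* d
  P = 2 ^ (2 ℕ.* p ℕ.+ 1)
  C₀ = p C t
  C₁ = suc p C suc t
  C₂ = suc p C suc (suc t)
  pull-out : ∀ a P C₁ rest → a ℕ.* (4 ℕ.* P ℕ.* C₁) ℕ.+ rest ≡ 4 ℕ.* P ℕ.* (a ℕ.* C₁) ℕ.+ rest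
  pull-out = ℕSolver.solve-∀
  collect : ∀ t d P C₂ C₀ →
    4 ℕ.* P ℕ.* (4 ℕ.* (suc (suc t) ℕ.* (3 ℕ.* t ℕ.+ 4 ℕ.* d ℕ.+ 2)) ℕ.* C₂ ℕ.+ (suc (2 ℕ.* (t ℕ.+ d)) ℕ.* suc (suc (2 ℕ.* (t ℕ.+ d)))) ℕ.* C₀)
      ℕ.+ 4 ℕ.* ((t ℕ.+ 2 ℕ.* d) ℕ.* (t ℕ.+ 2 ℕ.* d)) ℕ.* (4 ℕ.* P ℕ.* C₂)
    ≡ 4 ℕ.* (4 ℕ.* (suc (t ℕ.+ d) ℕ.* suc (t ℕ.+ d))) ℕ.* (4 ℕ.* P ℕ.* C₂) ℕ.+ 4 ℕ.* (P ℕ.* C₀) ℕ.* (suc (2 ℕ.* (t ℕ.+ d)) ℕ.* suc (suc (2 ℕ.* (t ℕ.+ d))))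
  collect = ℕSolver.solve-∀

-- Increasing the upper index adds exactly one term of
-- the defining sum, which gives the recurrence
--   h_{k,n+1} = h_{k,n} + h_{k-1,n}/n²,
-- and h_{k,n} vanishes below the diagonal n < k.

-- By definition, h_{k+2,n+1} = Σ_{i < n ∸ k} hSummand k i  (the j = k+1+i term).
hSummand : ℕ → ℕ → ℚ
hSummand k i = inv ((suc k ℕ.+ i) ℕ.* (suc k ℕ.+ i)) * h (suc k) (suc k ℕ.+ i)

h-vanish : ∀ k n → n < k → h (suc k) (suc n) ≡ 0ℚ
h-vanish (suc k) n (s≤s n≤k) = cong (λ L → sumℚ L (hSummand k)) (ℕP.m≤n⇒m∸n≡0 n≤k)

h-step : ∀ k n → h (suc k) (suc n) ≡ h (suc k) n + inv (n ℕ.* n) * h k n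
h-step zero    n       = sym (trans (cong (λ x → 1ℚ + x) (*-zeroʳ (inv (n ℕ.* n)))) (+-identityʳ 1ℚ))
h-step (suc k) zero    = sym (trans (cong (λ x → sumℚ (0 ∸ k) (hSummand k) + x) (*-zeroˡ (h (suc k) 0))) (+-identityʳ _))
h-step (suc k) (suc n) with k ℕ.≤? n
... | yes k≤n = begin
  sumℚ (suc n ∸ k) (hSummand k)                         ≡⟨ cong (λ L → sumℚ L (hSummand k)) (ℕP.+-∸-assoc 1 k≤n) ⟩
  sumℚ (n ∸ k) (hSummand k) + hSummand k (n ∸ k)        ≡⟨ cong (λ j → sumℚ (n ∸ k) (hSummand k) + inv (j ℕ.* j) * h (suc k) j) (ℕP.m+[n∸m]≡n (s≤s k≤n)) ⟩
  sumℚ (n ∸ k) (hSummand k) + inv (suc n ℕ.* suc n) * h (suc k) (suc n) ∎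
  where open ≡-Reasoning
... | no k≰n = begin
  sumℚ (suc n ∸ k) (hSummand k)  ≡⟨ cong (λ L → sumℚ L (hSummand k)) (ℕP.m≤n⇒m∸n≡0 n<k) ⟩
  0ℚ                             ≡⟨ sym (+-identityʳ 0ℚ) ⟩
  0ℚ + 0ℚ                        ≡⟨ cong₂ _+_ (sym (h-vanish (suc k) n (ℕP.m<n⇒m<1+n n<k))) (sym vanishing-term) ⟩
  sumℚ (n ∸ k) (hSummand k) + inv (suc n ℕ.* suc n) * h (suc k) (suc n) ∎
  where
  open ≡-Reasoning
  n<k = ℕP.≰⇒> k≰n
  vanishing-term : inv (suc n ℕ.* suc n) * h (suc k) (suc n) ≡ 0ℚ
  vanishing-term = trans (cong (inv (suc n ℕ.* suc n) *_) (h-vanish k n n<k)) (*-zeroʳ (inv (suc n ℕ.* suc n)))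

-- v without the case distinction: the closed form for v_{n,k+1} vanishes by
-- itself when n ≤ k (through h, or through inv 0 = 0 when n = 0).

ν : ℕ → ℚ
ν n = inv (n ℕ.* n ℕ.* ((2 ℕ.* n) C n))

vForm : ℕ → ℕ → ℚ
vForm n k = sgn n * ℕ→ℚ ((2 ℕ.* suc k) !) * ℕ→ℚ (2 ^ (2 ℕ.* (n ∸ suc k))) * ν n * h (suc k) n

vForm-vanish : ∀ n k → n ≤ k → vForm n k ≡ 0ℚ
vForm-vanish zero    k _ = trans (cong (_* h (suc k) 0) (*-zeroʳ (sgn 0 * ℕ→ℚ ((2 ℕ.* suc k) !) * ℕ→ℚ (2 ^ (2 ℕ.* (0 ∸ suc k)))))) (*-zeroˡ (h (suc k) 0))
vForm-vanish (suc n) k n<k = trans (cong (prefactor *_) (h-vanish k n n<k)) (*-zeroʳ prefactor)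
  where prefactor = sgn (suc n) * ℕ→ℚ ((2 ℕ.* suc k) !) * ℕ→ℚ (2 ^ (2 ℕ.* (suc n ∸ suc k))) * ν (suc n)

v≡vForm : ∀ n k → v n (suc k) ≡ vForm n k
v≡vForm n k with suc k ≤ᵇ n in eq
... | true  = refl
... | false = sym (vForm-vanish n k (ℕP.≤-pred (ℕP.≰⇒> (λ k<n → subst IsTrue eq (ℕP.≤⇒≤ᵇ k<n)))))

ν-step : ∀ m → ℕ→ℚ (τ (suc m)) * ν (suc (suc m)) ≡ ℕ→ℚ (suc m ℕ.* suc m) * ν (suc m)
ν-step m = begin
  ℕ→ℚ (τ n) * inv (suc n ℕ.* suc n ℕ.* ((2 ℕ.* suc n) C suc n)) ≡⟨ cong (λ x → ℕ→ℚ (τ n) * inv x) (central-step n) ⟩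
  ℕ→ℚ (τ n) * inv (τ n ℕ.* central)                            ≡⟨ ℕ→ℚ*inv-cancel {τ n} (s≤s z≤n) central-pos ⟩
  inv central                                                 ≡⟨ sym (ℕ→ℚ*inv-cancel {n ℕ.* n} (s≤s z≤n) central-pos) ⟩
  ℕ→ℚ (n ℕ.* n) * inv (n ℕ.* n ℕ.* central)                    ∎
  where
  open ≡-Reasoning
  n = suc m
  central = (2 ℕ.* n) C n
  central-pos : 1 ≤ central
  central-pos = C-pos (ℕP.m≤m+n n (n ℕ.+ 0))

-- 4 · 4^{n-k-1} h_{k+1,n} = 4^{n-k} h_{k+1,n} for n ≥ 1; when k ≥ n both
-- sides vanish through h, so no case condition remains.
power-shift : ∀ m k → ℕ→ℚ 4 * ℕ→ℚ (2 ^ (2 ℕ.* (m ∸ k))) * h (suc k) (suc m)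
                    ≡ ℕ→ℚ (2 ^ (2 ℕ.* (suc m ∸ k))) * h (suc k) (suc m)
power-shift m k with k ℕ.≤? m
... | yes k≤m = cong (_* h (suc k) (suc m)) (sym (begin
  ℕ→ℚ (2 ^ (2 ℕ.* (suc m ∸ k)))       ≡⟨ cong (λ e → ℕ→ℚ (2 ^ (2 ℕ.* e))) (ℕP.+-∸-assoc 1 k≤m) ⟩
  ℕ→ℚ (2 ^ (2 ℕ.* suc (m ∸ k)))       ≡⟨ cong ℕ→ℚ (4^-step (m ∸ k)) ⟩
  ℕ→ℚ (4 ℕ.* 2 ^ (2 ℕ.* (m ∸ k)))     ≡⟨ ℕ→ℚ-* 4 (2 ^ (2 ℕ.* (m ∸ k))) ⟩
  ℕ→ℚ 4 * ℕ→ℚ (2 ^ (2 ℕ.* (m ∸ k)))   ∎))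
  where open ≡-Reasoning
... | no k≰m = begin
  left * h (suc k) (suc m)   ≡⟨ cong (left *_) vanish ⟩
  left * 0ℚ                  ≡⟨ *-zeroʳ left ⟩
  0ℚ                         ≡⟨ sym (*-zeroʳ right) ⟩
  right * 0ℚ                 ≡⟨ sym (cong (right *_) vanish) ⟩
  right * h (suc k) (suc m)  ∎
  where
  open ≡-Reasoning
  left = ℕ→ℚ 4 * ℕ→ℚ (2 ^ (2 ℕ.* (m ∸ k)))
  right = ℕ→ℚ (2 ^ (2 ℕ.* (suc m ∸ k)))
  vanish = h-vanish k m (ℕP.≰⇒> k≰m)

factorial-step : ∀ k → (2 ℕ.* suc k) ! ≡ τ k ℕ.* (2 ℕ.* k) !
factorial-step k = trans (cong _! (double-suc k)) (regroup (2 ℕ.* k) ((2 ℕ.* k) !))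
  where
  double-suc : ∀ k → 2 ℕ.* suc k ≡ suc (suc (2 ℕ.* k))
  double-suc = ℕSolver.solve-∀
  regroup : ∀ x f → suc (suc x) ℕ.* (suc x ℕ.* f) ≡ suc x ℕ.* suc (suc x) ℕ.* f
  regroup = ℕSolver.solve-∀

-- The term that couples v_{n,k+1} to v_{n,k} in the recurrence.
coupling : ℕ → ℕ → ℚ
coupling n k = sgn n * ℕ→ℚ ((2 ℕ.* suc k) !) * ℕ→ℚ (2 ^ (2 ℕ.* (n ∸ k))) * ν n * h k n

coupling-as-v : ∀ n k → ℕ→ℚ (τ k) * v n k ≡ coupling n k
coupling-as-v n zero    = trans (*-zeroʳ (ℕ→ℚ (τ 0))) (sym (*-zeroʳ (sgn n * ℕ→ℚ 2 * ℕ→ℚ (2 ^ (2 ℕ.* (n ∸ 0))) * ν n)))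
coupling-as-v n (suc k) = begin
  ℕ→ℚ (τ (suc k)) * v n (suc k)                    ≡⟨ cong (ℕ→ℚ (τ (suc k)) *_) (v≡vForm n k) ⟩
  ℕ→ℚ (τ (suc k)) * (s * F * G * ν n * H)           ≡⟨ solve 6 (λ t s F G ν H → t :* (s :* F :* G :* ν :* H) := s :* (t :* F) :* G :* ν :* H) refl (ℕ→ℚ (τ (suc k))) s F G (ν n) H ⟩
  s * (ℕ→ℚ (τ (suc k)) * F) * G * ν n * H           ≡⟨ cong (λ x → s * x * G * ν n * H) (sym (trans (cong ℕ→ℚ (factorial-step (suc k))) (ℕ→ℚ-* (τ (suc k)) ((2 ℕ.* suc k) !)))) ⟩
  s * ℕ→ℚ ((2 ℕ.* suc (suc k)) !) * G * ν n * H     ∎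
  where
  open ≡-Reasoning
  s = sgn n
  F = ℕ→ℚ ((2 ℕ.* suc k) !)
  G = ℕ→ℚ (2 ^ (2 ℕ.* (n ∸ suc k)))
  H = h (suc k) n

recurrence-algebra : ∀ s F G G′ ν₀ ν₁ H₁ H₀ u N R →
  R * ν₁ ≡ N * ν₀ → N * u ≡ 1ℚ → ℕ→ℚ 4 * G′ * H₁ ≡ G * H₁ →
  R * ((- s) * F * G * ν₁ * (H₁ + u * H₀)) + (ℕ→ℚ 4 * N) * (s * F * G′ * ν₀ * H₁) + s * F * G * ν₀ * H₀ ≡ 0ℚ
recurrence-algebra s F G G′ ν₀ ν₁ H₁ H₀ u N R normalisation inverse power = begin
  R * ((- s) * F * G * ν₁ * (H₁ + u * H₀)) + (ℕ→ℚ 4 * N) * (s * F * G′ * ν₀ * H₁) + s * F * G * ν₀ * H₀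
    ≡⟨ solve 12 (λ s F G G′ ν₀ ν₁ H₁ H₀ u N R four →
         R :* ((:- s) :* F :* G :* ν₁ :* (H₁ :+ u :* H₀)) :+ (four :* N) :* (s :* F :* G′ :* ν₀ :* H₁) :+ s :* F :* G :* ν₀ :* H₀
         := :- (s :* F :* G) :* (R :* ν₁) :* H₁ :- (s :* F :* G) :* (R :* ν₁) :* u :* H₀ :+ (s :* F :* N :* ν₀) :* (four :* G′ :* H₁) :+ s :* F :* G :* ν₀ :* H₀)
         refl s F G G′ ν₀ ν₁ H₁ H₀ u N R (ℕ→ℚ 4) ⟩
  - (s * F * G) * (R * ν₁) * H₁ - (s * F * G) * (R * ν₁) * u * H₀ + (s * F * N * ν₀) * (ℕ→ℚ 4 * G′ * H₁) + s * F * G * ν₀ * H₀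
    ≡⟨ cong₂ (λ x y → - (s * F * G) * x * H₁ - (s * F * G) * x * u * H₀ + (s * F * N * ν₀) * y + s * F * G * ν₀ * H₀) normalisation power ⟩
  - (s * F * G) * (N * ν₀) * H₁ - (s * F * G) * (N * ν₀) * u * H₀ + (s * F * N * ν₀) * (G * H₁) + s * F * G * ν₀ * H₀
    ≡⟨ solve 8 (λ s F G ν₀ H₁ H₀ u N →
         :- (s :* F :* G) :* (N :* ν₀) :* H₁ :- (s :* F :* G) :* (N :* ν₀) :* u :* H₀ :+ (s :* F :* N :* ν₀) :* (G :* H₁) :+ s :* F :* G :* ν₀ :* H₀
         := s :* F :* G :* ν₀ :* H₀ :* (con 1ℚ :- N :* u))
         refl s F G ν₀ H₁ H₀ u N ⟩
  s * F * G * ν₀ * H₀ * (1ℚ - N * u)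
    ≡⟨ cong (λ x → s * F * G * ν₀ * H₀ * (1ℚ - x)) inverse ⟩
  s * F * G * ν₀ * H₀ * (1ℚ - 1ℚ)
    ≡⟨ trans (cong (s * F * G * ν₀ * H₀ *_) (+-inverseʳ 1ℚ)) (*-zeroʳ (s * F * G * ν₀ * H₀)) ⟩
  0ℚ ∎
  where open ≡-Reasoning

v-recurrence : ∀ m k →
  ℕ→ℚ (τ (suc m)) * v (suc (suc m)) (suc k) + ℕ→ℚ (4 ℕ.* (suc m ℕ.* suc m)) * v (suc m) (suc k) + ℕ→ℚ (τ k) * v (suc m) k ≡ 0ℚ
v-recurrence m k = begin
  ℕ→ℚ (τ n) * v (suc n) (suc k) + ℕ→ℚ (4 ℕ.* (n ℕ.* n)) * v n (suc k) + ℕ→ℚ (τ k) * v n k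
    ≡⟨ cong₂ _+_ (cong₂ (λ x y → ℕ→ℚ (τ n) * x + y) (v≡vForm (suc n) k) (cong₂ _*_ (ℕ→ℚ-* 4 (n ℕ.* n)) (v≡vForm n k))) (coupling-as-v n k) ⟩
  ℕ→ℚ (τ n) * vForm (suc n) k + ℕ→ℚ 4 * ℕ→ℚ (n ℕ.* n) * vForm n k + coupling n k
    ≡⟨ cong (λ x → ℕ→ℚ (τ n) * ((- sgn n) * F * G * ν (suc n) * x) + ℕ→ℚ 4 * ℕ→ℚ (n ℕ.* n) * vForm n k + coupling n k) (h-step k n) ⟩
  ℕ→ℚ (τ n) * ((- sgn n) * F * G * ν (suc n) * (h (suc k) n + inv (n ℕ.* n) * h k n)) + ℕ→ℚ 4 * ℕ→ℚ (n ℕ.* n) * vForm n k + coupling n k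
    ≡⟨ recurrence-algebra (sgn n) F G (ℕ→ℚ (2 ^ (2 ℕ.* (n ∸ suc k)))) (ν n) (ν (suc n)) (h (suc k) n) (h k n) (inv (n ℕ.* n)) (ℕ→ℚ (n ℕ.* n)) (ℕ→ℚ (τ n))
         (ν-step m) (inv-inverseʳ (m ℕ.+ m ℕ.* n)) (power-shift m k) ⟩
  0ℚ ∎
  where
  open ≡-Reasoning
  n = suc m
  F = ℕ→ℚ ((2 ℕ.* suc k) !)
  G = ℕ→ℚ (2 ^ (2 ℕ.* (n ∸ k)))

D : ℕ → ℚ
D j = ℕ→ℚ (2 ^ (2 ℕ.* j ℕ.+ 1))

D-step : ∀ k → D (suc k) ≡ ℕ→ℚ 4 * D k
D-step k = trans (cong ℕ→ℚ (pow-step k)) (ℕ→ℚ-* 4 (2 ^ (2 ℕ.* k ℕ.+ 1)))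

vSum : ℕ → ℕ → (ℕ → ℕ) → ℕ → ℚ
vSum n₀ L c j = sumℚ L (λ i → ℕ→ℚ (c i) * v (n₀ ℕ.+ i) j)

Expansion : ℕ → ℕ → (ℕ → ℕ) → ℕ → Set
Expansion n₀ L c T = ∀ j → vSum n₀ L c j ≡ D j * v T j

shift : (ℕ → ℕ) → ℕ → ℕ
shift c zero    = 0
shift c (suc i) = c i

Expansion-unshift : ∀ {n₀ L c T} → Expansion n₀ (suc L) (shift c) T → Expansion (suc n₀) L c T
Expansion-unshift {n₀} {L} {c} {T} E j = begin
  sumℚ L (λ i → ℕ→ℚ (c i) * v (suc n₀ ℕ.+ i) j)           ≡⟨ sum-cong L (λ i _ → cong (λ n → ℕ→ℚ (c i) * v n j) (sym (ℕP.+-suc n₀ i))) ⟩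
  sumℚ L (λ i → ℕ→ℚ (c i) * v (n₀ ℕ.+ suc i) j)           ≡⟨ sym (sum-drop-head L _ (*-zeroˡ (v (n₀ ℕ.+ 0) j))) ⟩
  vSum n₀ (suc L) (shift c) j                           ≡⟨ E j ⟩
  D j * v T j                                           ∎
  where open ≡-Reasoning

-- The summand that both sides of the transfer step below reduce to:
-- c·(16n² - 4T²)·v_{n,k+1} + 4c·τ(n)·v_{n+1,k+1}.
transferTerm : ℕ → ℕ → ℕ → ℕ → ℚ
transferTerm T n c k =
  (ℕ→ℚ (4 ℕ.* (4 ℕ.* (n ℕ.* n)) ℕ.* c) - ℕ→ℚ (4 ℕ.* (T ℕ.* T) ℕ.* c)) * v n (suc k)
  + ℕ→ℚ (4 ℕ.* c ℕ.* τ n) * v (suc n) (suc k)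

+-vanishing : ∀ Y μ {z} → z ≡ 0ℚ → Y + μ * z ≡ Y
+-vanishing Y μ z≡0 = trans (cong (λ z → Y + μ * z) z≡0) (trans (cong (λ x → Y + x) (*-zeroʳ μ)) (+-identityʳ Y))

-- Applying the recurrence to the target v_{T+1,k+1}, and then to every
-- summand of the expansion of v_T (used at j = k+1 and at j = k), expresses
-- τ(T)·2^{2k+3}·v_{T+1,k+1} as a sum of transfer terms.
expansion-recurrence : ∀ {n₀ T} L c → 1 ≤ n₀ → 1 ≤ T → Expansion n₀ L c T → ∀ k →
  ℕ→ℚ (τ T) * (D (suc k) * v (suc T) (suc k)) ≡ sumℚ L (λ i → transferTerm T (n₀ ℕ.+ i) (c i) k)
expansion-recurrence {suc m₀} {suc T′} L c _ _ E k = begin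
  ℕ→ℚ (τ T) * (D (suc k) * v (suc T) (suc k))
    ≡⟨ target-step ⟩
  (- A) * (D (suc k) * v T (suc k)) + (- (ℕ→ℚ 4 * W)) * (D k * v T k)
    ≡⟨ cong₂ (λ x y → (- A) * x + (- (ℕ→ℚ 4 * W)) * y) (sym (E (suc k))) (sym (E k)) ⟩
  (- A) * vSum n₀ L c (suc k) + (- (ℕ→ℚ 4 * W)) * vSum n₀ L c k
    ≡⟨ sym (cong₂ _+_ (sum-*ˡ L (- A) _) (sum-*ˡ L (- (ℕ→ℚ 4 * W)) _)) ⟩
  sumℚ L (λ i → (- A) * (ℕ→ℚ (c i) * v (n₀ ℕ.+ i) (suc k))) + sumℚ L (λ i → (- (ℕ→ℚ 4 * W)) * (ℕ→ℚ (c i) * v (n₀ ℕ.+ i) k))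
    ≡⟨ sym (sum-+ L _ _) ⟩
  sumℚ L (λ i → (- A) * (ℕ→ℚ (c i) * v (n₀ ℕ.+ i) (suc k)) + (- (ℕ→ℚ 4 * W)) * (ℕ→ℚ (c i) * v (n₀ ℕ.+ i) k))
    ≡⟨ sum-cong L (λ i _ → summand-step (m₀ ℕ.+ i) (c i)) ⟩
  sumℚ L (λ i → transferTerm T (n₀ ℕ.+ i) (c i) k) ∎
  where
  open ≡-Reasoning
  n₀ = suc m₀
  T = suc T′
  A = ℕ→ℚ (4 ℕ.* (T ℕ.* T))
  W = ℕ→ℚ (τ k)
  target-step : ℕ→ℚ (τ T) * (D (suc k) * v (suc T) (suc k))
              ≡ (- A) * (D (suc k) * v T (suc k)) + (- (ℕ→ℚ 4 * W)) * (D k * v T k)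
  target-step = begin
    ℕ→ℚ (τ T) * (D (suc k) * v (suc T) (suc k))
      ≡⟨ cong (λ d → ℕ→ℚ (τ T) * (d * v (suc T) (suc k))) (D-step k) ⟩
    ℕ→ℚ (τ T) * (ℕ→ℚ 4 * D k * v (suc T) (suc k))
      ≡⟨ solve 8 (λ R A W four d v′ v₁ v₀ →
            R :* (four :* d :* v′) := (:- A) :* (four :* d :* v₁) :+ (:- (four :* W)) :* (d :* v₀) :+ (four :* d) :* (R :* v′ :+ A :* v₁ :+ W :* v₀))
           refl (ℕ→ℚ (τ T)) A W (ℕ→ℚ 4) (D k) (v (suc T) (suc k)) (v T (suc k)) (v T k) ⟩
    (- A) * (ℕ→ℚ 4 * D k * v T (suc k)) + (- (ℕ→ℚ 4 * W)) * (D k * v T k) + (ℕ→ℚ 4 * D k) * (ℕ→ℚ (τ T) * v (suc T) (suc k) + A * v T (suc k) + W * v T k)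
      ≡⟨ +-vanishing _ (ℕ→ℚ 4 * D k) (v-recurrence T′ k) ⟩
    (- A) * (ℕ→ℚ 4 * D k * v T (suc k)) + (- (ℕ→ℚ 4 * W)) * (D k * v T k)
      ≡⟨ cong (λ d → (- A) * (d * v T (suc k)) + (- (ℕ→ℚ 4 * W)) * (D k * v T k)) (sym (D-step k)) ⟩
    (- A) * (D (suc k) * v T (suc k)) + (- (ℕ→ℚ 4 * W)) * (D k * v T k) ∎
  summand-step : ∀ m c → (- A) * (ℕ→ℚ c * v (suc m) (suc k)) + (- (ℕ→ℚ 4 * W)) * (ℕ→ℚ c * v (suc m) k)
                       ≡ transferTerm T (suc m) c k
  summand-step m c = begin
    (- A) * (γ * x) + (- (ℕ→ℚ 4 * W)) * (γ * y)
      ≡⟨ solve 9 (λ A W four γ An Rn x x′ y →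
            (:- A) :* (γ :* x) :+ (:- (four :* W)) :* (γ :* y)
            := (four :* An :* γ :- A :* γ) :* x :+ four :* γ :* Rn :* x′ :+ (:- (four :* γ)) :* (Rn :* x′ :+ An :* x :+ W :* y))
           refl A W (ℕ→ℚ 4) γ An Rn x x′ y ⟩
    (ℕ→ℚ 4 * An * γ - A * γ) * x + ℕ→ℚ 4 * γ * Rn * x′ + (- (ℕ→ℚ 4 * γ)) * (Rn * x′ + An * x + W * y)
      ≡⟨ +-vanishing _ (- (ℕ→ℚ 4 * γ)) (v-recurrence m k) ⟩
    (ℕ→ℚ 4 * An * γ - A * γ) * x + ℕ→ℚ 4 * γ * Rn * x′
      ≡⟨ sym (cong₂ (λ p q → p * x + q * x′) (cong₂ _-_ sixteen-n² four-T²) four-τ) ⟩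
    transferTerm T n c k ∎
    where
    n = suc m
    γ = ℕ→ℚ c
    An = ℕ→ℚ (4 ℕ.* (n ℕ.* n))
    Rn = ℕ→ℚ (τ n)
    x = v n (suc k)
    x′ = v (suc n) (suc k)
    y = v n k
    sixteen-n² : ℕ→ℚ (4 ℕ.* (4 ℕ.* (n ℕ.* n)) ℕ.* c) ≡ ℕ→ℚ 4 * An * γ
    sixteen-n² = trans (ℕ→ℚ-* (4 ℕ.* (4 ℕ.* (n ℕ.* n))) c) (cong (_* γ) (ℕ→ℚ-* 4 (4 ℕ.* (n ℕ.* n))))
    four-T² : ℕ→ℚ (4 ℕ.* (T ℕ.* T) ℕ.* c) ≡ A * γ
    four-T² = ℕ→ℚ-* (4 ℕ.* (T ℕ.* T)) c
    four-τ : ℕ→ℚ (4 ℕ.* c ℕ.* τ n) ≡ ℕ→ℚ 4 * γ * Rn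
    four-τ = trans (ℕ→ℚ-* (4 ℕ.* c) (τ n)) (cong (_* Rn) (ℕ→ℚ-* 4 c))

TransferConditionAt : ℕ → ℕ → (ℕ → ℕ) → (ℕ → ℕ) → ℕ → Set
TransferConditionAt n₀ T c e i =
  τ T ℕ.* e i ℕ.+ 4 ℕ.* (T ℕ.* T) ℕ.* c i
    ≡ 4 ℕ.* (4 ℕ.* ((n₀ ℕ.+ i) ℕ.* (n₀ ℕ.+ i))) ℕ.* c i ℕ.+ shift (λ i → 4 ℕ.* c i ℕ.* τ (n₀ ℕ.+ i)) i

TransferCondition : ℕ → ℕ → ℕ → (ℕ → ℕ) → (ℕ → ℕ) → Set
TransferCondition n₀ T L c e = ∀ i → i ≤ L → TransferConditionAt n₀ T c e i

ℕ→ℚ-transpose : ∀ a b c d → a ℕ.+ b ≡ c ℕ.+ d → ℕ→ℚ a ≡ ℕ→ℚ c + ℕ→ℚ d - ℕ→ℚ b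
ℕ→ℚ-transpose a b c d eq = begin
  ℕ→ℚ a                               ≡⟨ solve 2 (λ a b → a := a :+ b :- b) refl (ℕ→ℚ a) (ℕ→ℚ b) ⟩
  ℕ→ℚ a + ℕ→ℚ b - ℕ→ℚ b               ≡⟨ cong (_- ℕ→ℚ b) (trans (sym (ℕ→ℚ-+ a b)) (trans (cong ℕ→ℚ eq) (ℕ→ℚ-+ c d))) ⟩
  ℕ→ℚ c + ℕ→ℚ d - ℕ→ℚ b               ∎
  where open ≡-Reasoning

-- Under the transfer condition, τ(T) times the new sum is the same sum of
-- transfer terms: the first part of each condition stays at index i, the
-- second part moves from index i+1 back to index i.
transfer-coefficients : ∀ {n₀ T} L (c e : ℕ → ℕ) → c L ≡ 0 → TransferCondition n₀ T L c e → ∀ k →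
  ℕ→ℚ (τ T) * vSum n₀ (suc L) e (suc k) ≡ sumℚ L (λ i → transferTerm T (n₀ ℕ.+ i) (c i) k)
transfer-coefficients {n₀} {T} L c e top condition k = begin
  ℕ→ℚ (τ T) * vSum n₀ (suc L) e (suc k)
    ≡⟨ sym (sum-*ˡ (suc L) (ℕ→ℚ (τ T)) _) ⟩
  sumℚ (suc L) (λ i → ℕ→ℚ (τ T) * (ℕ→ℚ (e i) * x i))
    ≡⟨ sum-cong (suc L) (λ i i<1+L → split-summand i (ℕP.≤-pred i<1+L)) ⟩
  sumℚ (suc L) (λ i → diagonal i + carried i)
    ≡⟨ sum-+ (suc L) diagonal carried ⟩
  sumℚ (suc L) diagonal + sumℚ (suc L) carried
    ≡⟨ cong₂ _+_ (trans (cong (λ z → sumℚ L diagonal + z) diagonal-top) (+-identityʳ (sumℚ L diagonal))) (sum-drop-head L carried (*-zeroˡ (x 0))) ⟩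
  sumℚ L diagonal + sumℚ L (λ i → carried (suc i))
    ≡⟨ sym (sum-+ L diagonal _) ⟩
  sumℚ L (λ i → diagonal i + carried (suc i))
    ≡⟨ sum-cong L (λ i _ → cong (λ n → diagonal i + ℕ→ℚ (4 ℕ.* c i ℕ.* τ (n₀ ℕ.+ i)) * v n (suc k)) (ℕP.+-suc n₀ i)) ⟩
  sumℚ L (λ i → transferTerm T (n₀ ℕ.+ i) (c i) k) ∎
  where
  open ≡-Reasoning
  x : ℕ → ℚ
  x i = v (n₀ ℕ.+ i) (suc k)
  diagonal : ℕ → ℚ
  diagonal i = (ℕ→ℚ (4 ℕ.* (4 ℕ.* ((n₀ ℕ.+ i) ℕ.* (n₀ ℕ.+ i))) ℕ.* c i) - ℕ→ℚ (4 ℕ.* (T ℕ.* T) ℕ.* c i)) * x i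
  carried : ℕ → ℚ
  carried i = ℕ→ℚ (shift (λ i → 4 ℕ.* c i ℕ.* τ (n₀ ℕ.+ i)) i) * x i
  split-summand : ∀ i → i ≤ L → ℕ→ℚ (τ T) * (ℕ→ℚ (e i) * x i) ≡ diagonal i + carried i
  split-summand i i≤L = begin
    ℕ→ℚ (τ T) * (ℕ→ℚ (e i) * x i)    ≡⟨ sym (*-assoc (ℕ→ℚ (τ T)) _ _) ⟩
    ℕ→ℚ (τ T) * ℕ→ℚ (e i) * x i      ≡⟨ cong (_* x i) (sym (ℕ→ℚ-* (τ T) (e i))) ⟩
    ℕ→ℚ (τ T ℕ.* e i) * x i          ≡⟨ cong (_* x i) (ℕ→ℚ-transpose (τ T ℕ.* e i) (4 ℕ.* (T ℕ.* T) ℕ.* c i) (4 ℕ.* (4 ℕ.* ((n₀ ℕ.+ i) ℕ.* (n₀ ℕ.+ i))) ℕ.* c i) (shift (λ i → 4 ℕ.* c i ℕ.* τ (n₀ ℕ.+ i)) i) (condition i i≤L)) ⟩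
    (p + q - r) * x i               ≡⟨ solve 4 (λ p q r x → (p :+ q :- r) :* x := (p :- r) :* x :+ q :* x) refl p q r (x i) ⟩
    diagonal i + carried i          ∎
    where
    p = ℕ→ℚ (4 ℕ.* (4 ℕ.* ((n₀ ℕ.+ i) ℕ.* (n₀ ℕ.+ i))) ℕ.* c i)
    q = ℕ→ℚ (shift (λ i → 4 ℕ.* c i ℕ.* τ (n₀ ℕ.+ i)) i)
    r = ℕ→ℚ (4 ℕ.* (T ℕ.* T) ℕ.* c i)
  diagonal-top : diagonal L ≡ 0ℚ
  diagonal-top = begin
    diagonal L                                                   ≡⟨ cong (λ z → (ℕ→ℚ (a ℕ.* z) - ℕ→ℚ (b ℕ.* z)) * x L) top ⟩
    (ℕ→ℚ (a ℕ.* 0) - ℕ→ℚ (b ℕ.* 0)) * x L                          ≡⟨ cong₂ (λ y z → (ℕ→ℚ y - ℕ→ℚ z) * x L) (ℕP.*-zeroʳ a) (ℕP.*-zeroʳ b) ⟩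
    (0ℚ - 0ℚ) * x L                                              ≡⟨ *-zeroˡ (x L) ⟩
    0ℚ                                                           ∎
    where
    a = 4 ℕ.* (4 ℕ.* ((n₀ ℕ.+ L) ℕ.* (n₀ ℕ.+ L)))
    b = 4 ℕ.* (T ℕ.* T)

transfer : ∀ {n₀ T} L (c e : ℕ → ℕ) → 1 ≤ n₀ → 1 ≤ T → c L ≡ 0 → TransferCondition n₀ T L c e →
  Expansion n₀ L c T → Expansion n₀ (suc L) e (suc T)
transfer {n₀} {T} L c e _ _ _ _ _ zero =
  trans (sum-zero (suc L) {λ i → ℕ→ℚ (e i) * 0ℚ} (λ i → *-zeroʳ (ℕ→ℚ (e i)))) (sym (*-zeroʳ (D 0)))
transfer {n₀} {suc T′} L c e n₀≥1 T≥1 top condition E (suc k) = ℕ→ℚ-cancelˡ {τ (suc T′)} (s≤s z≤n)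
  (trans (transfer-coefficients {n₀} {suc T′} L c e top condition k) (sym (expansion-recurrence {n₀} {suc T′} L c n₀≥1 T≥1 E k)))

-- The coefficients of the two identities (the factor (M-k)/(2k+1) of the
-- first one is absorbed into the binomial, see odd-summand below):
--   v_{2M-1} ~ Σ_{i<M} σ(M+i, 2i+1) v_{M+i},   v_{2M} ~ Σ_{i≤M} σ(M+i, 2i) v_{M+i}.
aCoef : ℕ → ℕ → ℕ
aCoef M i = σ (M ℕ.+ i) (suc (2 ℕ.* i))

bCoef : ℕ → ℕ → ℕ
bCoef M i = σ (M ℕ.+ i) (2 ℕ.* i)

aCoef-top : ∀ M → aCoef M M ≡ 0
aCoef-top M = trans (cong (2 ^ (2 ℕ.* (M ℕ.+ M) ℕ.+ 1) ℕ.*_) (k>n⇒nCk≡0 (s≤s (ℕP.≤-reflexive (cong (M ℕ.+_) (sym (ℕP.+-identityʳ M)))))))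
                    (ℕP.*-zeroʳ (2 ^ (2 ℕ.* (M ℕ.+ M) ℕ.+ 1)))

bCoef-top : ∀ M → bCoef M (suc M) ≡ 0
bCoef-top M = trans (cong (2 ^ (2 ℕ.* (M ℕ.+ suc M) ℕ.+ 1) ℕ.*_) (k>n⇒nCk≡0 (ℕP.≤-reflexive (index M))))
                    (ℕP.*-zeroʳ (2 ^ (2 ℕ.* (M ℕ.+ suc M) ℕ.+ 1)))
  where
  index : ∀ M → suc (M ℕ.+ suc M) ≡ 2 ℕ.* suc M
  index = ℕSolver.solve-∀

-- From v_{2M-1} to v_{2M}: the odd coefficients transfer to the even ones.
-- At i = 0 the condition is a polynomial identity; for i = j+1 it is the
-- σ-identity with t = 2j+1 and d = M-1-j.
odd-to-even-condition : ∀ m → TransferCondition (suc m) (suc (2 ℕ.* m)) (suc m) (aCoef (suc m)) (bCoef (suc m))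
odd-to-even-condition m zero _ = begin
  τ T ℕ.* (P ℕ.* 1) ℕ.+ 4 ℕ.* (T ℕ.* T) ℕ.* (P ℕ.* ((M ℕ.+ 0) C 1))
    ≡⟨ cong (λ z → τ T ℕ.* (P ℕ.* 1) ℕ.+ 4 ℕ.* (T ℕ.* T) ℕ.* (P ℕ.* z)) (nC1≡n (M ℕ.+ 0)) ⟩
  τ T ℕ.* (P ℕ.* 1) ℕ.+ 4 ℕ.* (T ℕ.* T) ℕ.* (P ℕ.* (M ℕ.+ 0))
    ≡⟨ polynomial m P ⟩
  4 ℕ.* (4 ℕ.* ((M ℕ.+ 0) ℕ.* (M ℕ.+ 0))) ℕ.* (P ℕ.* (M ℕ.+ 0)) ℕ.+ 0
    ≡⟨ cong (λ z → 4 ℕ.* (4 ℕ.* ((M ℕ.+ 0) ℕ.* (M ℕ.+ 0))) ℕ.* (P ℕ.* z) ℕ.+ 0) (sym (nC1≡n (M ℕ.+ 0))) ⟩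
  4 ℕ.* (4 ℕ.* ((M ℕ.+ 0) ℕ.* (M ℕ.+ 0))) ℕ.* (P ℕ.* ((M ℕ.+ 0) C 1)) ℕ.+ 0 ∎
  where
  open ≡-Reasoning
  M = suc m
  T = suc (2 ℕ.* m)
  P = 2 ^ (2 ℕ.* (M ℕ.+ 0) ℕ.+ 1)
  polynomial : ∀ m P →
    suc (2 ℕ.* suc (2 ℕ.* m)) ℕ.* suc (suc (2 ℕ.* suc (2 ℕ.* m))) ℕ.* (P ℕ.* 1) ℕ.+ 4 ℕ.* (suc (2 ℕ.* m) ℕ.* suc (2 ℕ.* m)) ℕ.* (P ℕ.* (suc m ℕ.+ 0))
      ≡ 4 ℕ.* (4 ℕ.* ((suc m ℕ.+ 0) ℕ.* (suc m ℕ.+ 0))) ℕ.* (P ℕ.* (suc m ℕ.+ 0)) ℕ.+ 0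
  polynomial = ℕSolver.solve-∀
odd-to-even-condition m (suc j) (s≤s j≤m) =
  subst (λ m → TransferConditionAt (suc m) (suc (2 ℕ.* m)) (aCoef (suc m)) (bCoef (suc m)) (suc j))
        (ℕP.m+[n∸m]≡n j≤m) (interior j (m ∸ j))
  where
  interior : ∀ j d → TransferConditionAt (suc (j ℕ.+ d)) (suc (2 ℕ.* (j ℕ.+ d))) (aCoef (suc (j ℕ.+ d))) (bCoef (suc (j ℕ.+ d))) (suc j)
  interior j d = σ-identity (suc (2 ℕ.* j)) d (n-eq j d) (n-eq j d) (u-eq j) (cong suc (u-eq j)) (p-eq j d) (T-eq j d)
    where
    n-eq : ∀ j d → suc (j ℕ.+ d) ℕ.+ suc j ≡ suc (suc (2 ℕ.* j) ℕ.+ d)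
    n-eq = ℕSolver.solve-∀
    u-eq : ∀ j → 2 ℕ.* suc j ≡ suc (suc (2 ℕ.* j))
    u-eq = ℕSolver.solve-∀
    p-eq : ∀ j d → suc (j ℕ.+ d) ℕ.+ j ≡ suc (2 ℕ.* j) ℕ.+ d
    p-eq = ℕSolver.solve-∀
    T-eq : ∀ j d → suc (2 ℕ.* (j ℕ.+ d)) ≡ suc (2 ℕ.* j) ℕ.+ 2 ℕ.* d
    T-eq = ℕSolver.solve-∀

-- At i = 0 both sides carry the factor
-- 16M² - 4(2M)² = 0; for i = j+1 it is the σ-identity with t = 2j, d = M-j.
even-to-odd-condition : ∀ M → TransferCondition M (2 ℕ.* M) (suc M) (bCoef M) (shift (aCoef (suc M)))
even-to-odd-condition M zero _ = polynomial M (bCoef M 0)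
  where
  polynomial : ∀ M s →
    suc (2 ℕ.* (2 ℕ.* M)) ℕ.* suc (suc (2 ℕ.* (2 ℕ.* M))) ℕ.* 0 ℕ.+ 4 ℕ.* (2 ℕ.* M ℕ.* (2 ℕ.* M)) ℕ.* s
      ≡ 4 ℕ.* (4 ℕ.* ((M ℕ.+ 0) ℕ.* (M ℕ.+ 0))) ℕ.* s ℕ.+ 0
  polynomial = ℕSolver.solve-∀
even-to-odd-condition M (suc j) (s≤s j≤M) =
  subst (λ M → TransferConditionAt M (2 ℕ.* M) (bCoef M) (shift (aCoef (suc M))) (suc j))
        (ℕP.m+[n∸m]≡n j≤M) (interior j (M ∸ j))
  where
  interior : ∀ j d → TransferConditionAt (j ℕ.+ d) (2 ℕ.* (j ℕ.+ d)) (bCoef (j ℕ.+ d)) (shift (aCoef (suc (j ℕ.+ d)))) (suc j)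
  interior j d = σ-identity (2 ℕ.* j) d (n-eq j d) (n′-eq j d) refl (u′-eq j) (p-eq j d) (T-eq j d)
    where
    n-eq : ∀ j d → suc (j ℕ.+ d) ℕ.+ j ≡ suc (2 ℕ.* j ℕ.+ d)
    n-eq = ℕSolver.solve-∀
    n′-eq : ∀ j d → j ℕ.+ d ℕ.+ suc j ≡ suc (2 ℕ.* j ℕ.+ d)
    n′-eq = ℕSolver.solve-∀
    u′-eq : ∀ j → 2 ℕ.* suc j ≡ suc (suc (2 ℕ.* j))
    u′-eq = ℕSolver.solve-∀
    p-eq : ∀ j d → j ℕ.+ d ℕ.+ j ≡ 2 ℕ.* j ℕ.+ d
    p-eq = ℕSolver.solve-∀
    T-eq : ∀ j d → 2 ℕ.* (j ℕ.+ d) ≡ 2 ℕ.* j ℕ.+ 2 ℕ.* d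
    T-eq = ℕSolver.solve-∀

OddExpansion : ℕ → Set
OddExpansion m = Expansion (suc m) (suc m) (aCoef (suc m)) (suc (2 ℕ.* m))

EvenExpansion : ℕ → Set
EvenExpansion m = Expansion (suc m) (suc (suc m)) (bCoef (suc m)) (2 ℕ.* suc m)

-- M = 1: 2³·C(1,1)·v_{1,j} = 2^{2j+1}·v_{1,j}, since v_{1,j} = 0 for j ≠ 1
-- and the case j = 1 is a computation.
odd-base : OddExpansion 0
odd-base zero                = refl
odd-base (suc zero)          = refl
odd-base (suc (suc k))       = sym (*-zeroʳ (D (suc (suc k))))

odd-to-even : ∀ m → OddExpansion m → EvenExpansion m
odd-to-even m E = subst (Expansion (suc m) (suc (suc m)) (bCoef (suc m))) (double-suc m)
  (transfer {suc m} {suc (2 ℕ.* m)} (suc m) (aCoef (suc m)) (bCoef (suc m)) (s≤s z≤n) (s≤s z≤n)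
            (aCoef-top (suc m)) (odd-to-even-condition m) E)
  where
  double-suc : ∀ m → suc (suc (2 ℕ.* m)) ≡ 2 ℕ.* suc m
  double-suc = ℕSolver.solve-∀

even-to-odd : ∀ m → EvenExpansion m → OddExpansion (suc m)
even-to-odd m E = Expansion-unshift {suc m} {suc (suc m)} {aCoef (suc (suc m))} {suc (2 ℕ.* suc m)}
  (transfer {suc m} {2 ℕ.* suc m} (suc (suc m)) (bCoef (suc m)) (shift (aCoef (suc (suc m)))) (s≤s z≤n) (s≤s z≤n)
            (bCoef-top (suc m)) (even-to-odd-condition (suc m)) E)

expansions : ∀ m → OddExpansion m × EvenExpansion m
expansions zero    = odd-base , odd-to-even 0 odd-base
expansions (suc m) = odd , odd-to-even (suc m) odd
  where odd = even-to-odd m (proj₂ (expansions m))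

odd-summand : ∀ M k x →
  ℕ→ℚ (2 ^ (2 ℕ.* (M ℕ.+ k) ℕ.+ 1)) * (ℕ→ℚ (M ∸ k) * inv (2 ℕ.* k ℕ.+ 1)) * ℕ→ℚ ((M ℕ.+ k) C (2 ℕ.* k)) * x
    ≡ ℕ→ℚ (aCoef M k) * x
odd-summand M k x = begin
  P * (ℕ→ℚ (M ∸ k) * inv (2 ℕ.* k ℕ.+ 1)) * ℕ→ℚ (n C (2 ℕ.* k)) * x
    ≡⟨ cong (λ i → P * (ℕ→ℚ (M ∸ k) * inv i) * ℕ→ℚ (n C (2 ℕ.* k)) * x) (ℕP.+-comm (2 ℕ.* k) 1) ⟩
  P * (ℕ→ℚ (M ∸ k) * ι) * ℕ→ℚ (n C (2 ℕ.* k)) * x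
    ≡⟨ solve 5 (λ P m ι c x → P :* (m :* ι) :* c :* x := P :* ι :* (m :* c) :* x) refl P (ℕ→ℚ (M ∸ k)) ι (ℕ→ℚ (n C (2 ℕ.* k))) x ⟩
  P * ι * (ℕ→ℚ (M ∸ k) * ℕ→ℚ (n C (2 ℕ.* k))) * x
    ≡⟨ cong (λ z → P * ι * z * x) ratio ⟩
  P * ι * (ℕ→ℚ (suc (2 ℕ.* k)) * ℕ→ℚ (n C suc (2 ℕ.* k))) * x
    ≡⟨ solve 5 (λ P ι s c x → P :* ι :* (s :* c) :* x := P :* (ι :* s) :* c :* x) refl P ι (ℕ→ℚ (suc (2 ℕ.* k))) (ℕ→ℚ (n C suc (2 ℕ.* k))) x ⟩
  P * (ι * ℕ→ℚ (suc (2 ℕ.* k))) * ℕ→ℚ (n C suc (2 ℕ.* k)) * x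
    ≡⟨ cong (λ z → P * z * ℕ→ℚ (n C suc (2 ℕ.* k)) * x) (inv-inverseˡ (2 ℕ.* k)) ⟩
  P * 1ℚ * ℕ→ℚ (n C suc (2 ℕ.* k)) * x
    ≡⟨ cong (λ z → z * ℕ→ℚ (n C suc (2 ℕ.* k)) * x) (*-identityʳ P) ⟩
  P * ℕ→ℚ (n C suc (2 ℕ.* k)) * x
    ≡⟨ cong (_* x) (sym (ℕ→ℚ-* (2 ^ (2 ℕ.* n ℕ.+ 1)) (n C suc (2 ℕ.* k)))) ⟩
  ℕ→ℚ (aCoef M k) * x ∎
  where
  open ≡-Reasoning
  n = M ℕ.+ k
  P = ℕ→ℚ (2 ^ (2 ℕ.* n ℕ.+ 1))
  ι = inv (suc (2 ℕ.* k))
  -- (M-k)·C(M+k,2k) = (2k+1)·C(M+k,2k+1), as n - 2k = M - k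
  ratio : ℕ→ℚ (M ∸ k) * ℕ→ℚ (n C (2 ℕ.* k)) ≡ ℕ→ℚ (suc (2 ℕ.* k)) * ℕ→ℚ (n C suc (2 ℕ.* k))
  ratio = begin
    ℕ→ℚ (M ∸ k) * ℕ→ℚ (n C (2 ℕ.* k))          ≡⟨ sym (ℕ→ℚ-* (M ∸ k) (n C (2 ℕ.* k))) ⟩
    ℕ→ℚ ((M ∸ k) ℕ.* (n C (2 ℕ.* k)))         ≡⟨ cong (λ d → ℕ→ℚ (d ℕ.* (n C (2 ℕ.* k)))) (sym difference) ⟩
    ℕ→ℚ ((n ∸ 2 ℕ.* k) ℕ.* (n C (2 ℕ.* k)))   ≡⟨ cong ℕ→ℚ (sym (C-ratio n (2 ℕ.* k))) ⟩
    ℕ→ℚ (suc (2 ℕ.* k) ℕ.* (n C suc (2 ℕ.* k))) ≡⟨ ℕ→ℚ-* (suc (2 ℕ.* k)) (n C suc (2 ℕ.* k)) ⟩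
    ℕ→ℚ (suc (2 ℕ.* k)) * ℕ→ℚ (n C suc (2 ℕ.* k)) ∎
    where
    difference : n ∸ 2 ℕ.* k ≡ M ∸ k
    difference = trans (cong₂ _∸_ (ℕP.+-comm M k) (cong (k ℕ.+_) (ℕP.+-identityʳ k))) (ℕP.[m+n]∸[m+o]≡n∸o k M k)

-- Both identities: rewrite the summands into σ-coefficients and read off
-- the expansions for M = m + 1.
corollary2p9 : (M j : ℕ) → 1 ≤ M → 1 ≤ j →
    (sumℚ M (λ k → ℕ→ℚ (2 ^ (2 ℕ.* (M ℕ.+ k) ℕ.+ 1)) * (ℕ→ℚ (M ∸ k) * inv (2 ℕ.* k ℕ.+ 1)) * ℕ→ℚ ((M ℕ.+ k) C (2 ℕ.* k)) * v (M ℕ.+ k) j)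
    ≡ ℕ→ℚ (2 ^ (2 ℕ.* j ℕ.+ 1)) * v (2 ℕ.* M ∸ 1) j)
    ×
    (sumℚ (suc M) (λ k → ℕ→ℚ (2 ^ (2 ℕ.* (M ℕ.+ k) ℕ.+ 1)) * ℕ→ℚ ((M ℕ.+ k) C (2 ℕ.* k)) * v (M ℕ.+ k) j)
    ≡ ℕ→ℚ (2 ^ (2 ℕ.* j ℕ.+ 1)) * v (2 ℕ.* M) j)
corollary2p9 (suc m) j _ _ = odd-identity , even-identity
  where
  M = suc m
  odd-identity = begin
    sumℚ M (λ k → ℕ→ℚ (2 ^ (2 ℕ.* (M ℕ.+ k) ℕ.+ 1)) * (ℕ→ℚ (M ∸ k) * inv (2 ℕ.* k ℕ.+ 1)) * ℕ→ℚ ((M ℕ.+ k) C (2 ℕ.* k)) * v (M ℕ.+ k) j)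
      ≡⟨ sum-cong M (λ k _ → odd-summand M k (v (M ℕ.+ k) j)) ⟩
    vSum M M (aCoef M) j
      ≡⟨ proj₁ (expansions m) j ⟩
    D j * v (suc (2 ℕ.* m)) j
      ≡⟨ cong (λ n → D j * v n j) (sym (ℕP.+-suc m (m ℕ.+ 0))) ⟩
    D j * v (2 ℕ.* M ∸ 1) j ∎
    where open ≡-Reasoning
  even-identity = begin
    sumℚ (suc M) (λ k → ℕ→ℚ (2 ^ (2 ℕ.* (M ℕ.+ k) ℕ.+ 1)) * ℕ→ℚ ((M ℕ.+ k) C (2 ℕ.* k)) * v (M ℕ.+ k) j)
      ≡⟨ sum-cong (suc M) (λ k _ → cong (_* v (M ℕ.+ k) j) (sym (ℕ→ℚ-* (2 ^ (2 ℕ.* (M ℕ.+ k) ℕ.+ 1)) ((M ℕ.+ k) C (2 ℕ.* k))))) ⟩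
    vSum M (suc M) (bCoef M) j
      ≡⟨ proj₂ (expansions m) j ⟩
    D j * v (2 ℕ.* M) j ∎
    where open ≡-Reasoning
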